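{- Let $Z$ be an $n$-dimensional fake weighted projective space, and fix an isomorphism $\mathrm{Cl}(Z)\cong\mathbb{Z}\oplus\mathbb{Z}/\mu_1\mathbb{Z}\oplus\dots\oplus\mathbb{Z}/\mu_r\mathbb{Z}$ (with $\mu_r\mid\dots\mid\mu_1$) under which the classes of the torus-invariant prime divisors $D_0,\dots,D_n$ correspond to $\omega_i=(w_i,\eta_i)$ with $w_i\in\mathbb{Z}_{\ge1}$ and $\eta_i=(\eta_{i1},\dots,\eta_{ir})$, $\eta_{ij}\in\mathbb{Z}/\mu_j\mathbb{Z}$. Let $\eta'_{ij}\in\{0,\dots,\mu_j-1\}$ be the representative of $\eta_{ij}$, and set $L=\mathrm{lcm}(w_0,\dots,w_n)$, $L_{ij}=\frac{L}{w_i}\eta'_{ij}$, $M_j=\frac{\mu_j}{\gcd(\mu_j,L_{0j},\dots,L_{nj})}$ for $j=1,\dots,r$, and $M=\mathrm{lcm}(M_1,\dots,M_r)$. Then, under this identification, $\mathrm{Pic}(Z)$ is the subgroup generated by $(LM,0)$, and the Gorenstein index of $Z$ is $$\iota(Z)=\mathrm{lcm}\left(\frac{LM}{\gcd\left(LM,\sum_i w_i\right)},\ \frac{\mu_j}{\gcd\left(\mu_j,\sum_i\eta'_{ij}\right)};\ j=1,\dots,r\right).$$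
   Context: A fake weighted projective space (fwps) of dimension $n$ is the toric variety $Z=Z(P)$ whose fan has as maximal cones the cones over the facets of $\mathrm{conv}(v_0,\dots,v_n)$, where $P=[v_0,\dots,v_n]$ is an integer $n\times(n+1)$ matrix whose columns are pairwise distinct primitive vectors generating $\mathbb{R}^n$ as a convex cone; equivalently a $\mathbb{Q}$-factorial toric Fano variety of Picard number one. Its divisor class group is $\mathrm{Cl}(Z)\cong\mathbb{Z}^{n+1}/\mathrm{im}(P^{T})$, where $e_i$ maps to the class of the torus-invariant prime divisor $D_i$ corresponding to $v_i$. $\mathrm{Pic}(Z)\subseteq\mathrm{Cl}(Z)$ is the subgroup of classes of Cartier divisors. The anticanonical class is $\sum_i[D_i]$, and the Gorenstein index $\iota(Z)$ is the smallest positive integer $k$ such that $k$ times the anticanonical divisor is Cartier. -}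

module Defs where

open import Data.Nat as ℕ using (ℕ; zero; suc)
open import Data.Nat.GCD using (gcd)
open import Data.Nat.LCM using (lcm)
open import Data.Nat.DivMod using (_/_)
open import Data.Integer as ℤ using (ℤ; +_)
open import Data.Integer.Divisibility using () renaming (_∣_ to _∣ℤ_)
open import Data.Fin using (Fin; zero; suc; toℕ)
open import Data.Product using (Σ; ∃; ∃-syntax; _×_; _,_)
open import Relation.Binary.PropositionalEquality using (_≡_)
open import Function.Bundles using (_⇔_)
import Data.Nat.Divisibility

sumℤ : ∀ {k} → (Fin k → ℤ) → ℤ
sumℤ {zero}  f = + 0
sumℤ {suc k} f = f zero ℤ.+ sumℤ (λ i → f (suc i))

sumℕ : ∀ {k} → (Fin k → ℕ) → ℕ
sumℕ {zero}  f = 0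
sumℕ {suc k} f = f zero ℕ.+ sumℕ (λ i → f (suc i))

gcdF : ∀ {k} → (Fin k → ℕ) → ℕ
gcdF {zero}  f = 0
gcdF {suc k} f = gcd (f zero) (gcdF (λ i → f (suc i)))

lcmF : ∀ {k} → (Fin k → ℕ) → ℕ
lcmF {zero}  f = 1
lcmF {suc k} f = lcm (f zero) (lcmF (λ i → f (suc i)))

-- natural-number quotient; only ever applied with nonzero divisor
-- (division by 0 is set to 0 by convention and never occurs below)
_div_ : ℕ → ℕ → ℕ
m div zero    = 0
m div (suc d) = m / suc d

dot : ∀ {n} → (Fin n → ℤ) → (Fin n → ℤ) → ℤ
dot u x = sumℤ (λ k → u k ℤ.* x k)

-- Fake weighted projective spaces.
-- The matrix P = [v_0,...,v_n] is given by its columns v : Fin (suc n) → ℤ^n.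

record IsFWPS (n : ℕ) (v : Fin (suc n) → Fin n → ℤ) : Set where
  field
    distinct  : ∀ i j → (∀ k → v i k ≡ v j k) → i ≡ j
    primitiveCols : ∀ i (d : ℕ) → (∀ k → (+ d) ∣ℤ v i k) → d ≡ 1
    -- columns generate R^n as a convex cone (for rational cones it suffices
    -- that every integer vector has a positive multiple which is a
    -- nonnegative integer combination of the columns)
    spanning  : ∀ (x : Fin n → ℤ) →
                Σ ℕ λ c → Σ (Fin (suc n) → ℕ) λ a → ((1 ℕ.≤ c) ×
                  (∀ l → (+ c) ℤ.* x l ≡ sumℤ (λ i → (+ a i) ℤ.* v i l)))

-- Torus-invariant Weil divisors on Z are a : Fin (suc n) → ℤ,
-- meaning  Σ_i a_i D_i.
--
-- The cones of the fan of Z are the cones over the proper faces of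
-- conv(v_0,...,v_n).  A proper face is cut out by a supporting hyperplane
-- <u,x> = c with c > 0 (0 is an interior point) and u, c integral (the
-- polytope is rational); its vertices among the v_i are those with
-- <u,v_i> = c.  A torus-invariant divisor Σ a_i D_i is Cartier iff for
-- every cone σ of the fan there is m_σ ∈ M = Z^n with <m_σ, v_i> = -a_i
-- for every ray generator v_i of σ.
IsCartier : ∀ {n} → (Fin (suc n) → Fin n → ℤ) → (Fin (suc n) → ℤ) → Set
IsCartier {n} v a =
  ∀ (u : Fin n → ℤ) (c : ℤ) → ℤ.+0 ℤ.< c → (∀ i → dot u (v i) ℤ.≤ c) →
  ∃[ m ] (∀ i → dot u (v i) ≡ c → dot m (v i) ≡ ℤ.- a i)

-- The class of Σ a_i D_i in Cl(Z) = Z^{n+1}/im(P^T) lies in Pic(Z):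
-- it is linearly equivalent to a Cartier torus-invariant divisor b,
-- i.e. a - b = P^T u for some u.
InPic : ∀ {n} → (Fin (suc n) → Fin n → ℤ) → (Fin (suc n) → ℤ) → Set
InPic {n} v a =
  ∃[ b ] ∃[ u ] (IsCartier v b × (∀ i → a i ≡ b i ℤ.+ dot u (v i)))

-- k is the Gorenstein index: the least positive k with k·(-K_Z) = k·Σ D_i Cartier
IsGorensteinIndex : ∀ {n} → (Fin (suc n) → Fin n → ℤ) → ℕ → Set
IsGorensteinIndex v k =
  (1 ℕ.≤ k) × IsCartier v (λ _ → + k) ×
  (∀ k' → 1 ℕ.≤ k' → IsCartier v (λ _ → + k') → k ℕ.≤ k')

-- An identification Cl(Z) ≅ Z ⊕ Z/μ_1 ⊕ ... ⊕ Z/μ_r sending [D_i] to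
-- ω_i = (w_i, η_i), where η'_ij ∈ {0,...,μ_j - 1} represents η_ij.
-- (Indices j run over Fin r, i.e. 0..r-1 instead of 1..r.)
-- The induced map Z^{n+1} → Z ⊕ ⊕_j Z/μ_j is
--   a ↦ (Σ a_i w_i, (Σ a_i η'_ij mod μ_j)_j).

degOf : ∀ {n} → (Fin (suc n) → ℕ) → (Fin (suc n) → ℤ) → ℤ
degOf w a = sumℤ (λ i → a i ℤ.* (+ w i))

torOf : ∀ {n r} → (Fin (suc n) → Fin r → ℕ) → (Fin (suc n) → ℤ) → Fin r → ℤ
torOf η′ a j = sumℤ (λ i → a i ℤ.* (+ η′ i j))

record ClIdentification (n r : ℕ) (v : Fin (suc n) → Fin n → ℤ)
         (w : Fin (suc n) → ℕ) (μ : Fin r → ℕ)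
         (η′ : Fin (suc n) → Fin r → ℕ) : Set where
  field
    w-pos    : ∀ i → 1 ℕ.≤ w i
    μ-pos    : ∀ j → 1 ℕ.≤ μ j
    μ-chain  : ∀ (j k : Fin r) → toℕ j ℕ.≤ toℕ k → μ k Data.Nat.Divisibility.∣ μ j
    η′-range : ∀ i j → η′ i j ℕ.< μ j
    surj     : ∀ (z : ℤ) (t : Fin r → ℤ) →
               ∃[ a ] ((degOf w a ≡ z) × (∀ j → (+ μ j) ∣ℤ (torOf η′ a j ℤ.- t j)))
    kernel   : ∀ (a : Fin (suc n) → ℤ) →
               ((degOf w a ≡ + 0) × (∀ j → (+ μ j) ∣ℤ torOf η′ a j))
                 ⇔ (∃[ u ] (∀ i → a i ≡ dot u (v i)))

Lnum : ∀ {n} → (Fin (suc n) → ℕ) → ℕ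
Lnum w = lcmF w

Lij : ∀ {n r} → (Fin (suc n) → ℕ) → (Fin (suc n) → Fin r → ℕ) → Fin (suc n) → Fin r → ℕ
Lij w η′ i j = (Lnum w div w i) ℕ.* η′ i j

Mj : ∀ {n r} → (Fin (suc n) → ℕ) → (Fin r → ℕ) → (Fin (suc n) → Fin r → ℕ) → Fin r → ℕ
Mj w μ η′ j = μ j div gcd (μ j) (gcdF (λ i → Lij w η′ i j))

Mnum : ∀ {n r} → (Fin (suc n) → ℕ) → (Fin r → ℕ) → (Fin (suc n) → Fin r → ℕ) → ℕ
Mnum w μ η′ = lcmF (Mj w μ η′)

LM : ∀ {n r} → (Fin (suc n) → ℕ) → (Fin r → ℕ) → (Fin (suc n) → Fin r → ℕ) → ℕ
LM w μ η′ = Lnum w ℕ.* Mnum w μ η′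

iotaFormula : ∀ {n r} → (Fin (suc n) → ℕ) → (Fin r → ℕ) → (Fin (suc n) → Fin r → ℕ) → ℕ
iotaFormula w μ η′ =
  lcm (LM w μ η′ div gcd (LM w μ η′) (sumℕ w))
      (lcmF (λ j → μ j div gcd (μ j) (sumℕ (λ i → η′ i j))))

InSubgroupLM : ∀ {n r} → (Fin (suc n) → ℕ) → (Fin r → ℕ) → (Fin (suc n) → Fin r → ℕ) →
               (Fin (suc n) → ℤ) → Set
InSubgroupLM w μ η′ a =
  (∃[ k ] (degOf w a ≡ k ℤ.* (+ LM w μ η′))) × (∀ j → (+ μ j) ∣ℤ torOf η′ a j)

{-# OPTIONS --safe #-}

-- A torus-invariant divisor a is Cartier iff it is principal on every maximal cone
-- σᵢ = cone(vₗ : l ≢ i), i.e. iff a − k Dᵢ is principal for some k.  Each σᵢ is a cone of the fan,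
-- since N (wᵢ Σₗ Dₗ − (Σₗ wₗ) Dᵢ) is principal for N = lcm μ, and every proper face lies in some
-- σᵢ, since Σₗ wₗ vₗ = 0.  In Cl(Z) ≅ ℤ ⊕ ⨁ⱼ ℤ/μⱼ this says that the class (x , t) of a is a multiple
-- of every ωᵢ.  As the ωᵢ generate Cl(Z) this forces t = 0, and it then says wᵢ ∣ x and
-- μⱼ ∣ (x / wᵢ) η′ᵢⱼ for all i, j, which unwinds to L M ∣ x.  Cartier divisors are stable under
-- linear equivalence, which gives Pic(Z).  Finally k Σᵢ Dᵢ has class k (Σᵢ wᵢ , Σᵢ ηᵢ), so it is
-- Cartier iff L M ∣ k Σᵢ wᵢ and μⱼ ∣ k Σᵢ η′ᵢⱼ for all j, i.e. iff ι ∣ k.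

module Submission where

open import Defs
open import Data.Nat using (ℕ; suc)
open import Data.Integer using (ℤ)
open import Data.Fin using (Fin)
open import Data.Product using (_×_)
open import Function.Bundles using (_⇔_)

open import Data.Nat using (zero)
open import Data.Nat.Base using (NonZero)
open import Data.Fin using (zero; suc)
open import Data.Product using (_,_; proj₁; proj₂; ∃-syntax)
open import Data.Product.Function.NonDependent.Propositional using (_×-⇔_)
open import Data.Sum using (inj₁)
open import Function.Base using (_∘_)
open import Function.Bundles using (mk⇔; Equivalence)
open import Function.Construct.Composition using (_⇔-∘_)
open import Function.Construct.Symmetry using (⇔-sym)
open import Function.Related.Propositional using (module EquationalReasoning)
open import Relation.Binary.PropositionalEquality
open import Relation.Nullary using (¬_; yes; no)

Π-cong-⇔ : ∀ {A : Set} {P Q : A → Set} → (∀ x → P x ⇔ Q x) → (∀ x → P x) ⇔ (∀ x → Q x)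
Π-cong-⇔ P⇔Q = mk⇔ (λ p x → to (P⇔Q x) (p x)) (λ q x → from (P⇔Q x) (q x))
  where open Equivalence

module _ where
  open import Data.Integer using (_+_; _*_; -_; _-_; +_; 0ℤ; -1ℤ)
  open import Data.Integer.Properties
  open import Data.Integer.Divisibility.Signed using (_∣_; divides; ∣m∣n⇒∣m+n)
  open import Algebra.Properties.Semiring.Sum +-*-semiring
    using (sum; sum-cong-≗; ∑-distrib-+; *-distribˡ-sum)
  open import Data.Integer.Tactic.RingSolver using (solve-∀)
  open import Data.Vec.Functional using (updateAt)
  open import Data.Vec.Functional.Properties using (updateAt-updates; updateAt-minimal)

  sumℤ≡sum : ∀ {k} (f : Fin k → ℤ) → sumℤ f ≡ sum f
  sumℤ≡sum {zero}  f = refl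
  sumℤ≡sum {suc k} f = cong (_+_ (f zero)) (sumℤ≡sum (f ∘ suc))

  sumℤ-cong : ∀ {k} {f g : Fin k → ℤ} → (∀ i → f i ≡ g i) → sumℤ f ≡ sumℤ g
  sumℤ-cong {f = f} {g} f≗g
    rewrite sumℤ≡sum f | sumℤ≡sum g = sum-cong-≗ f≗g

  sumℤ-+ : ∀ {k} (f g : Fin k → ℤ) → sumℤ (λ i → f i + g i) ≡ sumℤ f + sumℤ g
  sumℤ-+ f g rewrite sumℤ≡sum (λ i → f i + g i) | sumℤ≡sum f | sumℤ≡sum g = ∑-distrib-+ f g

  sumℤ-*ˡ : ∀ {k} c (f : Fin k → ℤ) → sumℤ (λ i → c * f i) ≡ c * sumℤ f
  sumℤ-*ˡ c f rewrite sumℤ≡sum (λ i → c * f i) | sumℤ≡sum f = sym (*-distribˡ-sum c f)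

  sumℤ-neg : ∀ {k} (f : Fin k → ℤ) → sumℤ (λ i → - f i) ≡ - sumℤ f
  sumℤ-neg f = begin
    sumℤ (λ i → - f i)      ≡⟨ sumℤ-cong (λ i → -1*i≡-i (f i)) ⟨
    sumℤ (λ i → -1ℤ * f i)  ≡⟨ sumℤ-*ˡ -1ℤ f ⟩
    -1ℤ * sumℤ f            ≡⟨ -1*i≡-i (sumℤ f) ⟩
    - sumℤ f                ∎
    where open ≡-Reasoning

  sumℤ-minus : ∀ {k} (f g : Fin k → ℤ) → sumℤ (λ i → f i - g i) ≡ sumℤ f - sumℤ g
  sumℤ-minus f g = trans (sumℤ-+ f (-_ ∘ g)) (cong (_+_ (sumℤ f)) (sumℤ-neg g))

  sumℤ-pos : ∀ {k} (f : Fin k → ℕ) → sumℤ (λ i → + f i) ≡ + sumℕ f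
  sumℤ-pos {zero}  f = refl
  sumℤ-pos {suc k} f = cong (_+_ (+ f zero)) (sumℤ-pos (f ∘ suc))

  sumℤ-∣ : ∀ {k} {d} (f : Fin k → ℤ) → (∀ i → d ∣ f i) → d ∣ sumℤ f
  sumℤ-∣ {zero}  f d∣f = divides 0ℤ refl
  sumℤ-∣ {suc k} f d∣f = ∣m∣n⇒∣m+n (d∣f zero) (sumℤ-∣ (f ∘ suc) (d∣f ∘ suc))

  single : ∀ {k} → Fin k → ℤ → Fin k → ℤ
  single i c = updateAt (λ _ → 0ℤ) i (λ _ → c)

  single-≡ : ∀ {k} (i : Fin k) c → single i c i ≡ c
  single-≡ i c = updateAt-updates i (λ _ → 0ℤ)

  single-≢ : ∀ {k} {i l : Fin k} c → l ≢ i → single i c l ≡ 0ℤ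
  single-≢ {i = i} {l} c l≢i = updateAt-minimal l i (λ _ → 0ℤ) l≢i

  dot-minusˡ : ∀ {k} (a b c : Fin k → ℤ) → dot (λ i → a i - b i) c ≡ dot a c - dot b c
  dot-minusˡ a b c = trans (sumℤ-cong (λ i → distrib (a i) (b i) (c i)))
                           (sumℤ-minus (λ i → a i * c i) (λ i → b i * c i))
    where
    distrib : ∀ x y z → (x - y) * z ≡ x * z - y * z
    distrib = solve-∀

  dot-negˡ : ∀ {k} (a c : Fin k → ℤ) → dot (λ i → - a i) c ≡ - dot a c
  dot-negˡ a c = trans (sumℤ-cong (λ i → sym (neg-distribˡ-* (a i) (c i)))) (sumℤ-neg (λ i → a i * c i))

  dot-constˡ : ∀ {k} x (c : Fin k → ℤ) → dot (λ _ → x) c ≡ x * sumℤ c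
  dot-constˡ x c = sumℤ-*ˡ x c

  dot-zeroˡ : ∀ {k} (c : Fin k → ℤ) → dot (λ _ → 0ℤ) c ≡ 0ℤ
  dot-zeroˡ c = dot-constˡ 0ℤ c

  dot-singleˡ : ∀ {k} (i : Fin k) x (c : Fin k → ℤ) → dot (single i x) c ≡ x * c i
  dot-singleˡ zero    x c = trans (cong (_+_ (x * c zero)) (dot-zeroˡ (c ∘ suc))) (+-identityʳ _)
  dot-singleˡ (suc i) x c = trans (+-identityˡ _) (dot-singleˡ i x (c ∘ suc))

  dot-*ˡ : ∀ {k} x (a c : Fin k → ℤ) → dot (λ i → x * a i) c ≡ x * dot a c
  dot-*ˡ x a c = trans (sumℤ-cong (λ i → *-assoc x (a i) (c i))) (sumℤ-*ˡ x (λ i → a i * c i))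

module _ where
  open import Data.Nat
  open import Data.Nat.Properties
  open import Data.Nat.Divisibility
  open import Data.Nat.DivMod using (m/n*n≡m)
  open import Data.Nat.GCD
  open import Data.Nat.LCM
  open import Data.Nat.Coprimality using (coprime-/gcd; coprime-divisor)
  open Equivalence using (to; from)

  div≡/ : ∀ m d .{{_ : NonZero d}} → m div d ≡ m / d
  div≡/ m (suc d) = refl

  gcd≢0ˡ : ∀ m n .{{_ : NonZero m}} → NonZero (gcd m n)
  gcd≢0ˡ m n = ≢-nonZero (gcd[m,n]≢0 m n (inj₁ (≢-nonZero⁻¹ m)))

  lcm≢0 : ∀ m n .{{_ : NonZero m}} .{{_ : NonZero n}} → NonZero (lcm m n)
  lcm≢0 m n = m*n≢0⇒n≢0 (gcd m n) {{subst NonZero (sym (gcd*lcm m n)) (m*n≢0 m n)}}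

  /gcd≢0 : ∀ a b .{{_ : NonZero a}} → NonZero (a div gcd a b)
  /gcd≢0 a b = subst NonZero (sym (div≡/ a (gcd a b) {{g≢0}}))
                     (≢-nonZero (m/gcd[m,n]≢0 a b {{gcd≢0 = g≢0}}))
    where g≢0 = gcd≢0ˡ a b

  lcmF≢0 : ∀ {k} (f : Fin k → ℕ) → (∀ i → NonZero (f i)) → NonZero (lcmF f)
  lcmF≢0 {zero}  f f≢0 = _
  lcmF≢0 {suc k} f f≢0 =
    lcm≢0 (f zero) (lcmF (f ∘ suc)) {{f≢0 zero}} {{lcmF≢0 (f ∘ suc) (f≢0 ∘ suc)}}

  lcm∣⇔ : ∀ m n {c} → lcm m n ∣ c ⇔ (m ∣ c × n ∣ c)
  lcm∣⇔ m n = mk⇔ (λ l∣c → ∣-trans (m∣lcm[m,n] m n) l∣c , ∣-trans (n∣lcm[m,n] m n) l∣c)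
                  (λ (m∣c , n∣c) → lcm-least m∣c n∣c)

  lcmF∣⇔ : ∀ {k} (f : Fin k → ℕ) {c} → lcmF f ∣ c ⇔ (∀ i → f i ∣ c)
  lcmF∣⇔ {zero}  f = mk⇔ (λ _ ()) (λ _ → 1∣ _)
  lcmF∣⇔ {suc k} f = mk⇔
    (λ l∣c → λ { zero    → proj₁ (to (lcm∣⇔ _ _) l∣c)
               ; (suc i) → to (lcmF∣⇔ (f ∘ suc)) (proj₂ (to (lcm∣⇔ (f zero) _) l∣c)) i })
    (λ f∣c → from (lcm∣⇔ _ _) (f∣c zero , from (lcmF∣⇔ (f ∘ suc)) (f∣c ∘ suc)))

  ∣gcdF⇔ : ∀ {k} (f : Fin k → ℕ) {c} → c ∣ gcdF f ⇔ (∀ i → c ∣ f i)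
  ∣gcdF⇔ {zero}  f = mk⇔ (λ _ ()) (λ _ → _ ∣0)
  ∣gcdF⇔ {suc k} f = mk⇔
    (λ c∣g → λ { zero    → ∣-trans c∣g (gcd[m,n]∣m (f zero) _)
               ; (suc i) → to (∣gcdF⇔ (f ∘ suc)) (∣-trans c∣g (gcd[m,n]∣n (f zero) _)) i })
    (λ c∣f → gcd-greatest (c∣f zero) (from (∣gcdF⇔ (f ∘ suc)) (c∣f ∘ suc)))

  gcdF-*ˡ : ∀ {k} c (f : Fin k → ℕ) → gcdF (λ i → c * f i) ≡ c * gcdF f
  gcdF-*ˡ {zero}  c f = sym (*-zeroʳ c)
  gcdF-*ˡ {suc k} c f = begin
    gcd (c * f zero) (gcdF (λ i → c * f (suc i))) ≡⟨ cong (gcd (c * f zero)) (gcdF-*ˡ c (f ∘ suc)) ⟩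
    gcd (c * f zero) (c * gcdF (f ∘ suc))          ≡⟨ c*gcd[m,n]≡gcd[cm,cn] c _ _ ⟨
    c * gcd (f zero) (gcdF (f ∘ suc))              ∎
    where open ≡-Reasoning

  -- With g = gcd a b:  a ∣ k b  ⇔  a/g ∣ k (b/g)  ⇔  a/g ∣ k,  as a/g and b/g are coprime.
  /gcd∣⇔∣* : ∀ a b {k} .{{_ : NonZero a}} → a div gcd a b ∣ k ⇔ a ∣ k * b
  /gcd∣⇔∣* a b {k} = mk⇔
    (λ a′∣k → subst₂ _∣_ a′*g≡a k*b′*g≡k*b (*-monoˡ-∣ g (∣m⇒∣m*n b′ (subst (_∣ k) a/g≡a′ a′∣k))))
    (λ a∣kb → subst (_∣ k) (sym a/g≡a′) (coprime-divisor (coprime-/gcd a b)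
      (subst (a′ ∣_) (*-comm k b′) (*-cancelʳ-∣ g (subst₂ _∣_ (sym a′*g≡a) (sym k*b′*g≡k*b) a∣kb)))))
    where
    g = gcd a b
    instance
      g≢0 : NonZero g
      g≢0 = gcd≢0ˡ a b
    a′ = a / g
    b′ = b / g
    a/g≡a′ : a div g ≡ a′
    a/g≡a′ = div≡/ a g
    a′*g≡a : a′ * g ≡ a
    a′*g≡a = m/n*n≡m (gcd[m,n]∣m a b)
    k*b′*g≡k*b : k * b′ * g ≡ k * b
    k*b′*g≡k*b = trans (*-assoc k b′ g) (cong (k *_) (m/n*n≡m (gcd[m,n]∣n a b)))

  /gcd[gcdF]∣⇔ : ∀ a {k} (f : Fin k → ℕ) {z} .{{_ : NonZero a}} →
                 a div gcd a (gcdF f) ∣ z ⇔ (∀ i → a ∣ z * f i)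
  /gcd[gcdF]∣⇔ a f {z} = mk⇔
    (λ d∣z → to (∣gcdF⇔ _) (subst (a ∣_) (sym (gcdF-*ˡ z f)) (to (/gcd∣⇔∣* a _) d∣z)))
    (λ a∣zf → from (/gcd∣⇔∣* a _) (subst (a ∣_) (gcdF-*ˡ z f) (from (∣gcdF⇔ _) a∣zf)))

  *∣⇔ : ∀ a b {X} .{{_ : NonZero a}} → a * b ∣ X ⇔ (a ∣ X × b ∣ X / a)
  *∣⇔ a b {X} = mk⇔
    (λ ab∣X → let a∣X = m*n∣⇒m∣ a b ab∣X in
      a∣X , *-cancelˡ-∣ a (subst (a * b ∣_) (sym (a*[X/a]≡X a∣X)) ab∣X))
    (λ (a∣X , b∣X/a) → subst (a * b ∣_) (a*[X/a]≡X a∣X) (*-monoʳ-∣ a b∣X/a))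
    where
    a*[X/a]≡X : a ∣ X → a * (X / a) ≡ X
    a*[X/a]≡X a∣X = trans (*-comm a _) (m/n*n≡m a∣X)

  ∣-characterises-least : ∀ {P : ℕ → Set} d .{{_ : NonZero d}} → (∀ k → P k ⇔ d ∣ k) →
                          1 ≤ d × P d × (∀ k → 1 ≤ k → P k → d ≤ k)
  ∣-characterises-least d P⇔d∣ =
    >-nonZero⁻¹ d , from (P⇔d∣ d) ∣-refl ,
    λ k 1≤k Pk → ∣⇒≤ {{>-nonZero 1≤k}} (to (P⇔d∣ k) Pk)

module Invariants {n r} (w : Fin (suc n) → ℕ) (μ : Fin r → ℕ) (η′ : Fin (suc n) → Fin r → ℕ)
                  (w≢0 : ∀ i → NonZero (w i)) (μ≢0 : ∀ j → NonZero (μ j)) where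
  open import Data.Nat
  open import Data.Nat.Properties
  open import Data.Nat.Divisibility
  open import Data.Nat.DivMod using (m/n*n≡m; *-/-assoc)
  open import Data.Nat.GCD
  open import Data.Nat.LCM
  open Equivalence using (to; from)

  private
    L = Lnum w
    M = Mnum w μ η′
    instance
      w-nonZero : ∀ {i} → NonZero (w i)
      w-nonZero {i} = w≢0 i
      μ-nonZero : ∀ {j} → NonZero (μ j)
      μ-nonZero {j} = μ≢0 j

  instance
    L≢0 : NonZero L
    L≢0 = lcmF≢0 w w≢0

  M≢0 : NonZero M
  M≢0 = lcmF≢0 (Mj w μ η′) Mj≢0
    where
    Mj≢0 : ∀ j → NonZero (Mj w μ η′ j)
    Mj≢0 j = /gcd≢0 (μ j) _

  LM≢0 : NonZero (LM w μ η′)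
  LM≢0 = m*n≢0 L M {{L≢0}} {{M≢0}}

  M∣⇔ : ∀ {z} → M ∣ z ⇔ (∀ i j → μ j ∣ z * Lij w η′ i j)
  M∣⇔ = mk⇔
    (λ M∣z i j → to (/gcd[gcdF]∣⇔ (μ j) (Lj j)) (to (lcmF∣⇔ (Mj w μ η′)) M∣z j) i)
    (λ μ∣zL → from (lcmF∣⇔ (Mj w μ η′)) (λ j → from (/gcd[gcdF]∣⇔ (μ j) (Lj j)) (λ i → μ∣zL i j)))
    where
    Lj : Fin r → Fin (suc n) → ℕ
    Lj j i = Lij w η′ i j

  LM∣⇔ : ∀ X → LM w μ η′ ∣ X ⇔ ((∀ i → w i ∣ X) × (∀ i j → μ j ∣ X / w i * η′ i j))
  LM∣⇔ X = mk⇔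
    (λ LM∣X → let (L∣X , M∣X/L) = to LM∣⇔L∣×M∣ LM∣X in
      to (lcmF∣⇔ w) L∣X ,
      λ i j → subst (μ j ∣_) (X/L*Lij≡X/w*η′ L∣X i j) (to M∣⇔ M∣X/L i j))
    (λ (w∣X , μ∣X/w*η′) → let L∣X = from (lcmF∣⇔ w) w∣X in
      from LM∣⇔L∣×M∣ (L∣X , from M∣⇔ (λ i j →
        subst (μ j ∣_) (sym (X/L*Lij≡X/w*η′ L∣X i j)) (μ∣X/w*η′ i j))))
    where
    LM∣⇔L∣×M∣ = *∣⇔ L M {X}
    X/L*Lij≡X/w*η′ : L ∣ X → ∀ i j → X / L * Lij w η′ i j ≡ X / w i * η′ i j
    X/L*Lij≡X/w*η′ L∣X i j = begin
      X / L * (L div w i * η′ i j)   ≡⟨ cong (λ q → X / L * (q * η′ i j)) (div≡/ L (w i)) ⟩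
      X / L * (L / w i * η′ i j)     ≡⟨ *-assoc (X / L) _ _ ⟨
      X / L * (L / w i) * η′ i j     ≡⟨ cong (_* η′ i j) (*-/-assoc (X / L) (to (lcmF∣⇔ w) ∣-refl i)) ⟨
      X / L * L / w i * η′ i j       ≡⟨ cong (λ q → q / w i * η′ i j) (m/n*n≡m L∣X) ⟩
      X / w i * η′ i j               ∎
      where open ≡-Reasoning

  ι≢0 : NonZero (iotaFormula w μ η′)
  ι≢0 = lcm≢0 _ _ {{/gcd≢0 (LM w μ η′) (sumℕ w) {{LM≢0}}}}
                  {{lcmF≢0 _ (λ j → /gcd≢0 (μ j) (T j))}}
    where T = λ j → sumℕ (λ i → η′ i j)

  ι∣⇔ : ∀ k → iotaFormula w μ η′ ∣ k ⇔
               (LM w μ η′ ∣ k * sumℕ w × (∀ j → μ j ∣ k * sumℕ (λ i → η′ i j)))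
  ι∣⇔ k = mk⇔
    (λ ι∣k → let (ιW∣k , ιT∣k) = to (lcm∣⇔ ιW ιT) ι∣k in
      to (/gcd∣⇔∣* (LM w μ η′) W {{LM≢0}}) ιW∣k ,
      λ j → to (/gcd∣⇔∣* (μ j) (T j)) (to (lcmF∣⇔ ιTj) ιT∣k j))
    (λ (LM∣kW , μ∣kT) → from (lcm∣⇔ ιW ιT)
      ( from (/gcd∣⇔∣* (LM w μ η′) W {{LM≢0}}) LM∣kW
      , from (lcmF∣⇔ ιTj) (λ j → from (/gcd∣⇔∣* (μ j) (T j)) (μ∣kT j))))
    where
    W = sumℕ w
    T = λ j → sumℕ (λ i → η′ i j)
    ιW = LM w μ η′ div gcd (LM w μ η′) W
    ιTj = λ j → μ j div gcd (μ j) (T j)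
    ιT = lcmF ιTj

module Multiples {n r} (w : Fin (suc n) → ℕ) (μ : Fin r → ℕ) (η′ : Fin (suc n) → Fin r → ℕ)
                 (w≢0 : ∀ i → NonZero (w i)) (μ≢0 : ∀ j → NonZero (μ j)) where
  open import Data.Integer using (_*_; _-_; +_; 1ℤ; ∣_∣)
  open import Data.Integer.Properties using (abs-*; *-identityʳ)
  open import Data.Integer.Divisibility.Signed
    using (_∣_; divides; ∣ᵤ⇒∣; ∣⇒∣ᵤ; ∣m∣n⇒∣m-n; ∣m+n∣n⇒∣m; ∣m⇒∣-m; ∣n⇒∣m*n)
  open import Data.Integer.Tactic.RingSolver using (solve-∀)
  import Data.Nat as ℕ
  import Data.Nat.Divisibility as ℕ
  open import Data.Nat.DivMod using (m*n/n≡m)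
  open Equivalence using (to; from)
  open Invariants w μ η′ w≢0 μ≢0

  private instance
    w-nonZero : ∀ {i} → NonZero (w i)
    w-nonZero {i} = w≢0 i

  MultipleOfω : Fin (suc n) → ℤ → (Fin r → ℤ) → Set
  MultipleOfω i x t = ∃[ k ] (x ≡ k * + w i) × (∀ j → + μ j ∣ t j - k * + η′ i j)

  multipleOfω⇔ : ∀ {i x t} → (∀ j → + μ j ∣ t j) →
                 MultipleOfω i x t ⇔ (w i ℕ.∣ ∣ x ∣ × (∀ j → μ j ℕ.∣ ∣ x ∣ ℕ./ w i ℕ.* η′ i j))
  multipleOfω⇔ {i} {x} {t} μ∣t = mk⇔
    (λ (k , x≡kw , μ∣t-kη) →
      ∣⇒∣ᵤ (divides k x≡kw) ,
      λ j → subst (μ j ℕ.∣_) (∣kη∣≡ k j x≡kw)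
                  (∣⇒∣ᵤ (subst (+ μ j ∣_) (t-[t-y]≡y (t j) _) (∣m∣n⇒∣m-n (μ∣t j) (μ∣t-kη j)))))
    (λ (w∣x , μ∣x/w*η) → let divides k x≡kw = ∣ᵤ⇒∣ {+ w i} {x} w∣x in
      k , x≡kw , λ j → ∣m∣n⇒∣m-n (μ∣t j) (∣ᵤ⇒∣ (subst (μ j ℕ.∣_) (sym (∣kη∣≡ k j x≡kw)) (μ∣x/w*η j))))
    where
    t-[t-y]≡y : ∀ t y → t - (t - y) ≡ y
    t-[t-y]≡y = solve-∀
    ∣kη∣≡ : ∀ k j → x ≡ k * + w i → ∣ k * + η′ i j ∣ ≡ ∣ x ∣ ℕ./ w i ℕ.* η′ i j
    ∣kη∣≡ k j x≡kw = begin
      ∣ k * + η′ i j ∣                  ≡⟨ abs-* k _ ⟩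
      ∣ k ∣ ℕ.* η′ i j                  ≡⟨ cong (ℕ._* η′ i j) (m*n/n≡m ∣ k ∣ (w i)) ⟨
      ∣ k ∣ ℕ.* w i ℕ./ w i ℕ.* η′ i j  ≡⟨ cong (λ y → y ℕ./ w i ℕ.* η′ i j) (trans (cong ∣_∣ x≡kw) (abs-* k _)) ⟨
      ∣ x ∣ ℕ./ w i ℕ.* η′ i j          ∎
      where open ≡-Reasoning

  -- b has class (1 , 0), and t = Σᵢ bᵢ (wᵢ t − x ηᵢ) + x Σᵢ bᵢ ηᵢ, where every wᵢ t − x ηᵢ
  -- vanishes mod μ because (x , t) = kᵢ ωᵢ.
  multiplesOfω⇒torsion≡0 : (b : Fin (suc n) → ℤ) → degOf w b ≡ 1ℤ → (∀ j → + μ j ∣ torOf η′ b j) →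
                           ∀ {x t} → (∀ i → MultipleOfω i x t) → ∀ j → + μ j ∣ t j
  multiplesOfω⇒torsion≡0 b deg-b≡1 μ∣tor-b {x} {t} mult j =
    ∣m+n∣n⇒∣m (subst (+ μ j ∣_) Σ≡t-x*tor-b (sumℤ-∣ _ (λ i → ∣n⇒∣m*n (b i) (μ∣wt-xη i))))
              (∣m⇒∣-m (∣n⇒∣m*n x (μ∣tor-b j)))
    where
    μ∣wt-xη : ∀ i → + μ j ∣ + w i * t j - x * + η′ i j
    μ∣wt-xη i = let (k , x≡kw , μ∣t-kη) = mult i in
      subst (+ μ j ∣_)
            (trans (expand (+ w i) (t j) k (+ η′ i j)) (cong (λ y → + w i * t j - y * + η′ i j) (sym x≡kw)))
            (∣n⇒∣m*n (+ w i) (μ∣t-kη j))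
      where
      expand : ∀ w t k η → w * (t - k * η) ≡ w * t - k * w * η
      expand = solve-∀
    Σ≡t-x*tor-b : sumℤ (λ i → b i * (+ w i * t j - x * + η′ i j)) ≡ t j - x * torOf η′ b j
    Σ≡t-x*tor-b = begin
      sumℤ (λ i → b i * (+ w i * t j - x * + η′ i j))
        ≡⟨ sumℤ-cong (λ i → distrib (b i) (+ w i) (t j) x (+ η′ i j)) ⟩
      sumℤ (λ i → t j * (b i * + w i) - x * (b i * + η′ i j))
        ≡⟨ sumℤ-minus (λ i → t j * (b i * + w i)) (λ i → x * (b i * + η′ i j)) ⟩
      sumℤ (λ i → t j * (b i * + w i)) - sumℤ (λ i → x * (b i * + η′ i j))
        ≡⟨ cong₂ _-_ (sumℤ-*ˡ (t j) (λ i → b i * + w i)) (sumℤ-*ˡ x (λ i → b i * + η′ i j)) ⟩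
      t j * degOf w b - x * torOf η′ b j
        ≡⟨ cong (λ d → t j * d - x * torOf η′ b j) deg-b≡1 ⟩
      t j * 1ℤ - x * torOf η′ b j
        ≡⟨ cong (_- x * torOf η′ b j) (*-identityʳ (t j)) ⟩
      t j - x * torOf η′ b j
        ∎
      where
      open ≡-Reasoning
      distrib : ∀ b w t x η → b * (w * t - x * η) ≡ t * (b * w) - x * (b * η)
      distrib = solve-∀

  allMultiplesOfω⇔ : (b : Fin (suc n) → ℤ) → degOf w b ≡ 1ℤ → (∀ j → + μ j ∣ torOf η′ b j) →
                     ∀ x t → (∀ i → MultipleOfω i x t) ⇔ (+ LM w μ η′ ∣ x × (∀ j → + μ j ∣ t j))
  allMultiplesOfω⇔ b deg-b≡1 μ∣tor-b x t = mk⇔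
    (λ mult → let μ∣t = multiplesOfω⇒torsion≡0 b deg-b≡1 μ∣tor-b mult
                  conditions = λ i → to (multipleOfω⇔ μ∣t) (mult i) in
      ∣ᵤ⇒∣ (from (LM∣⇔ ∣ x ∣) (proj₁ ∘ conditions , proj₂ ∘ conditions)) , μ∣t)
    (λ (LM∣x , μ∣t) → let (w∣x , μ∣x/w*η) = to (LM∣⇔ ∣ x ∣) (∣⇒∣ᵤ LM∣x) in
      λ i → from (multipleOfω⇔ μ∣t) (w∣x i , μ∣x/w*η i))

  inSubgroupLM⇔ : ∀ a → InSubgroupLM w μ η′ a ⇔
                        (+ LM w μ η′ ∣ degOf w a × (∀ j → + μ j ∣ torOf η′ a j))
  inSubgroupLM⇔ a = mk⇔ (λ ((k , eq) , μ∣t) → divides k eq , ∣ᵤ⇒∣ ∘ μ∣t)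
                        (λ (divides k eq , μ∣t) → (k , eq) , ∣⇒∣ᵤ ∘ μ∣t)

module CartierDivisors {n r} {v : Fin (suc n) → Fin n → ℤ} {w : Fin (suc n) → ℕ} {μ : Fin r → ℕ}
                       {η′ : Fin (suc n) → Fin r → ℕ} (C : ClIdentification n r v w μ η′) where
  open import Data.Integer using (_+_; _*_; -_; _-_; +_; 0ℤ; 1ℤ; ∣_∣; _≤_; _<_; +<+; >-nonZero)
  open import Data.Integer.Properties
    using ( _≟_; +-identityʳ; *-zeroʳ; pos-*; neg-involutive; neg-distrib-+; i-j≡0⇒i≡j; i≡j⇒i-j≡0
          ; ≤-reflexive; i-j≤i; *-monoˡ-≤-nonNeg; i*j≢0)
  open import Data.Integer.Divisibility.Signed using (_∣_; ∣ᵤ⇒∣; ∣⇒∣ᵤ; ∣m⇒∣m*n)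
  open import Data.Integer.Tactic.RingSolver using (solve-∀)
  import Data.Nat as ℕ
  import Data.Nat.Properties as ℕ
  import Data.Nat.Divisibility as ℕ
  import Data.Fin.Properties as Fin
  open Equivalence using (to; from)
  open ClIdentification C

  private
    w≢0 : ∀ i → NonZero (w i)
    w≢0 i = ℕ.>-nonZero (w-pos i)
    μ≢0 : ∀ j → NonZero (μ j)
    μ≢0 j = ℕ.>-nonZero (μ-pos j)
    Divisor = Fin (suc n) → ℤ

  open Invariants w μ η′ w≢0 μ≢0 using (ι≢0; ι∣⇔)
  open Multiples w μ η′ w≢0 μ≢0

  Principal : Divisor → Set
  Principal a = ∃[ u ] (∀ i → a i ≡ dot u (v i))

  principal⇔classZero : ∀ a → Principal a ⇔ (degOf w a ≡ 0ℤ × (∀ j → + μ j ∣ torOf η′ a j))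
  principal⇔classZero a = mk⇔
    (λ p → let (deg≡0 , μ∣tor) = from (kernel a) p in deg≡0 , ∣ᵤ⇒∣ ∘ μ∣tor)
    (λ (deg≡0 , μ∣tor) → to (kernel a) (deg≡0 , ∣⇒∣ᵤ ∘ μ∣tor))

  -- a = N (wᵢ · Σₗ Dₗ − W · Dᵢ) with N = lcm μ has class zero, so a = Pᵀu; the linear form u
  -- takes the value N wᵢ on every vₗ with l ≢ i and a smaller value on vᵢ
  facetOpposite : ∀ i → ∃[ u ] ∃[ c ]
                  (0ℤ < c × (∀ l → dot u (v l) ≤ c) × (∀ l → l ≢ i → dot u (v l) ≡ c))
  facetOpposite i = u , + N * + w i , c>0 , bound , onFacet
    where
    N = lcmF μ
    W = sumℕ w
    N≢0 : NonZero N
    N≢0 = lcmF≢0 μ μ≢0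
    w′ : Divisor
    w′ l = + w l
    b : Divisor
    b l = + w i - single i (+ W) l
    a : Divisor
    a l = + N * b l
    deg-b≡0 : degOf w b ≡ 0ℤ
    deg-b≡0 = begin
      degOf w b
        ≡⟨ dot-minusˡ (λ _ → + w i) (single i (+ W)) w′ ⟩
      dot (λ _ → + w i) w′ - dot (single i (+ W)) w′
        ≡⟨ cong₂ _-_ (trans (dot-constˡ (+ w i) w′) (cong (+ w i *_) (sumℤ-pos w))) (dot-singleˡ i (+ W) w′) ⟩
      + w i * + W - + W * + w i
        ≡⟨ x*y-y*x≡0 (+ w i) (+ W) ⟩
      0ℤ
        ∎
      where
      open ≡-Reasoning
      x*y-y*x≡0 : ∀ x y → x * y - y * x ≡ 0ℤ
      x*y-y*x≡0 = solve-∀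
    a-principal : Principal a
    a-principal = from (principal⇔classZero a)
      ( trans (dot-*ˡ (+ N) b w′) (trans (cong (+ N *_) deg-b≡0) (*-zeroʳ (+ N)))
      , λ j → sumℤ-∣ (λ l → a l * + η′ l j) (λ l → ∣m⇒∣m*n (+ η′ l j) (∣m⇒∣m*n (b l) (μ∣N j))))
      where
      μ∣N : ∀ j → + μ j ∣ + N
      μ∣N j = ∣ᵤ⇒∣ (to (lcmF∣⇔ μ) ℕ.∣-refl j)
    u = proj₁ a-principal
    a≡u·v = proj₂ a-principal
    onFacet : ∀ l → l ≢ i → dot u (v l) ≡ + N * + w i
    onFacet l l≢i = begin
      dot u (v l)                           ≡⟨ a≡u·v l ⟨
      + N * (+ w i - single i (+ W) l)      ≡⟨ cong (λ s → + N * (+ w i - s)) (single-≢ (+ W) l≢i) ⟩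
      + N * (+ w i - 0ℤ)                    ≡⟨ cong (+ N *_) (+-identityʳ (+ w i)) ⟩
      + N * + w i                           ∎
      where open ≡-Reasoning
    bound : ∀ l → dot u (v l) ≤ + N * + w i
    bound l with l Fin.≟ i
    ... | no l≢i = ≤-reflexive (onFacet l l≢i)
    ... | yes refl =
      subst (_≤ + N * + w i) (trans (cong (λ s → + N * (+ w i - s)) (sym (single-≡ i (+ W)))) (a≡u·v i))
            (*-monoˡ-≤-nonNeg (+ N) (i-j≤i (+ w i) (+ W)))
    c>0 : 0ℤ < + N * + w i
    c>0 = subst (0ℤ <_) (pos-* N (w i))
                (+<+ (ℕ.>-nonZero⁻¹ (N ℕ.* w i) {{ℕ.m*n≢0 N (w i) {{N≢0}} {{w≢0 i}}}}))

  -- Σₗ wₗ vₗ = 0, so no affine hyperplane missing the origin contains every vₗ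
  ¬allOnHyperplane : ∀ u c → 0ℤ < c → ¬ (∀ l → dot u (v l) ≡ c)
  ¬allOnHyperplane u c c>0 allOn =
    ℕ.≢-nonZero⁻¹ ∣ c * + W ∣ {{i*j≢0 c (+ W) {{>-nonZero c>0}} {{W≢0}}}} (cong ∣_∣ c*W≡0)
    where
    W = sumℕ w
    W≢0 : NonZero W
    W≢0 = ℕ.>-nonZero (ℕ.≤-trans (w-pos zero) (ℕ.m≤m+n (w zero) _))
    w′ : Divisor
    w′ l = + w l
    c*W≡0 : c * + W ≡ 0ℤ
    c*W≡0 = begin
      c * + W                      ≡⟨ cong (c *_) (sumℤ-pos w) ⟨
      c * sumℤ w′                  ≡⟨ dot-constˡ c w′ ⟨
      dot (λ _ → c) w′             ≡⟨ sumℤ-cong (λ l → cong (_* + w l) (allOn l)) ⟨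
      degOf w (λ l → dot u (v l))  ≡⟨ proj₁ (to (principal⇔classZero _) (u , λ _ → refl)) ⟩
      0ℤ                           ∎
      where open ≡-Reasoning

  -- Cartier on the maximal cone spanned by the vₗ with l ≢ i
  LocallyPrincipalOn : Fin (suc n) → Divisor → Set
  LocallyPrincipalOn i a = ∃[ m ] (∀ l → l ≢ i → dot m (v l) ≡ - a l)

  isCartier⇔locallyPrincipal : ∀ a → IsCartier v a ⇔ (∀ i → LocallyPrincipalOn i a)
  isCartier⇔locallyPrincipal a = mk⇔ cartier⇒local local⇒cartier
    where
    cartier⇒local : IsCartier v a → ∀ i → LocallyPrincipalOn i a
    cartier⇒local cartier i with facetOpposite i
    ... | u , c , c>0 , bound , onFacet with cartier u c c>0 bound
    ... | m , m·v≡-a = m , λ l l≢i → m·v≡-a l (onFacet l l≢i)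

    local⇒cartier : (∀ i → LocallyPrincipalOn i a) → IsCartier v a
    local⇒cartier local u c c>0 bound
      with Fin.¬∀⟶∃¬ _ _ (λ l → dot u (v l) ≟ c) (¬allOnHyperplane u c c>0)
    ... | i , offFace with local i
    ... | m , m·v≡-a = m , λ l onFace → m·v≡-a l (λ { refl → offFace onFace })

  locallyPrincipalOn⇔principal : ∀ i a →
                                 LocallyPrincipalOn i a ⇔ (∃[ k ] Principal (λ l → a l - single i k l))
  locallyPrincipalOn⇔principal i a = mk⇔
    (λ (m , m·v≡-a) → a i + dot m (v i) , (λ q → - m q) ,
       λ l → trans (a-kDᵢ≡-m·v m m·v≡-a l) (sym (dot-negˡ m (v l))))
    (λ (k , u , a-kDᵢ≡u·v) → (λ q → - u q) , λ l l≢i → begin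
       dot (λ q → - u q) (v l)  ≡⟨ dot-negˡ u (v l) ⟩
       - dot u (v l)            ≡⟨ cong -_ (a-kDᵢ≡u·v l) ⟨
       - (a l - single i k l)   ≡⟨ cong (λ s → - (a l - s)) (single-≢ k l≢i) ⟩
       - (a l - 0ℤ)             ≡⟨ cong -_ (+-identityʳ (a l)) ⟩
       - a l                    ∎)
    where
    open ≡-Reasoning
    a-kDᵢ≡-m·v : ∀ m → (∀ l → l ≢ i → dot m (v l) ≡ - a l) →
                 ∀ l → a l - single i (a i + dot m (v i)) l ≡ - dot m (v l)
    a-kDᵢ≡-m·v m m·v≡-a l with l Fin.≟ i
    ... | yes refl = trans (cong (_-_ (a i)) (single-≡ i _)) (x-[x+y]≡-y (a i) (dot m (v i)))
      where
      x-[x+y]≡-y : ∀ x y → x - (x + y) ≡ - y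
      x-[x+y]≡-y = solve-∀
    ... | no l≢i = begin
      a l - single i _ l  ≡⟨ cong (_-_ (a l)) (single-≢ _ l≢i) ⟩
      a l - 0ℤ            ≡⟨ +-identityʳ (a l) ⟩
      a l                 ≡⟨ neg-involutive (a l) ⟨
      - - a l             ≡⟨ cong -_ (m·v≡-a l l≢i) ⟨
      - dot m (v l)       ∎

  principal[a-kDᵢ]⇔ : ∀ i a k → Principal (λ l → a l - single i k l) ⇔
                      (degOf w a ≡ k * + w i × (∀ j → + μ j ∣ torOf η′ a j - k * + η′ i j))
  principal[a-kDᵢ]⇔ i a k = mk⇔
    (λ p → let (deg≡0 , μ∣tor) = to (principal⇔classZero _) p in
      i-j≡0⇒i≡j _ _ (trans (sym (dot-minus-single (λ l → + w l))) deg≡0) ,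
      λ j → subst (+ μ j ∣_) (dot-minus-single (λ l → + η′ l j)) (μ∣tor j))
    (λ (deg≡kw , μ∣tor-kη) → from (principal⇔classZero _)
      ( trans (dot-minus-single (λ l → + w l)) (i≡j⇒i-j≡0 deg≡kw)
      , λ j → subst (+ μ j ∣_) (sym (dot-minus-single (λ l → + η′ l j))) (μ∣tor-kη j)))
    where
    dot-minus-single : ∀ c → dot (λ l → a l - single i k l) c ≡ dot a c - k * c i
    dot-minus-single c = trans (dot-minusˡ a (single i k) c) (cong (_-_ (dot a c)) (dot-singleˡ i k c))

  locallyPrincipalOn⇔multipleOfω : ∀ i a →
                                   LocallyPrincipalOn i a ⇔ MultipleOfω i (degOf w a) (torOf η′ a)
  locallyPrincipalOn⇔multipleOfω i a = mk⇔
    (λ local → let (k , p) = to (locallyPrincipalOn⇔principal i a) local in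
      k , to (principal[a-kDᵢ]⇔ i a k) p)
    (λ (k , mult) → from (locallyPrincipalOn⇔principal i a) (k , from (principal[a-kDᵢ]⇔ i a k) mult))

  isCartier-+principal : ∀ {a b} m₀ → IsCartier v b → (∀ i → a i ≡ b i + dot m₀ (v i)) →
                         IsCartier v a
  isCartier-+principal {a} {b} m₀ cartier a≡b+m₀·v u c c>0 bound with cartier u c c>0 bound
  ... | m , m·v≡-b = (λ q → m q - m₀ q) , λ i onFace → begin
    dot (λ q → m q - m₀ q) (v i)  ≡⟨ dot-minusˡ m m₀ (v i) ⟩
    dot m (v i) - dot m₀ (v i)    ≡⟨ cong (_- dot m₀ (v i)) (m·v≡-b i onFace) ⟩
    - b i - dot m₀ (v i)          ≡⟨ neg-distrib-+ (b i) (dot m₀ (v i)) ⟨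
    - (b i + dot m₀ (v i))        ≡⟨ cong -_ (a≡b+m₀·v i) ⟨
    - a i                         ∎
    where open ≡-Reasoning

  inPic⇔isCartier : ∀ a → InPic v a ⇔ IsCartier v a
  inPic⇔isCartier a = mk⇔
    (λ (b , m₀ , cartier , a≡b+m₀·v) → isCartier-+principal m₀ cartier a≡b+m₀·v)
    (λ cartier → a , (λ _ → 0ℤ) , cartier ,
                 λ i → sym (trans (cong (_+_ (a i)) (dot-zeroˡ (v i))) (+-identityʳ (a i))))

  unitDivisor : ∃[ b ] (degOf w b ≡ 1ℤ × (∀ j → + μ j ∣ torOf η′ b j))
  unitDivisor with surj 1ℤ (λ _ → 0ℤ)
  ... | b , deg≡1 , μ∣tor-0 = b , deg≡1 , λ j → subst (+ μ j ∣_) (+-identityʳ _) (∣ᵤ⇒∣ (μ∣tor-0 j))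

  isCartier⇔inSubgroupLM : ∀ a → IsCartier v a ⇔ InSubgroupLM w μ η′ a
  isCartier⇔inSubgroupLM a with unitDivisor
  ... | b , deg-b≡1 , μ∣tor-b = begin
    IsCartier v a
      ∼⟨ isCartier⇔locallyPrincipal a ⟩
    (∀ i → LocallyPrincipalOn i a)
      ∼⟨ Π-cong-⇔ (λ i → locallyPrincipalOn⇔multipleOfω i a) ⟩
    (∀ i → MultipleOfω i (degOf w a) (torOf η′ a))
      ∼⟨ allMultiplesOfω⇔ b deg-b≡1 μ∣tor-b _ _ ⟩
    (+ LM w μ η′ ∣ degOf w a × (∀ j → + μ j ∣ torOf η′ a j))
      ∼⟨ ⇔-sym (inSubgroupLM⇔ a) ⟩
    InSubgroupLM w μ η′ a
      ∎
    where open EquationalReasoning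

  inPic⇔inSubgroupLM : ∀ a → InPic v a ⇔ InSubgroupLM w μ η′ a
  inPic⇔inSubgroupLM a = isCartier⇔inSubgroupLM a ⇔-∘ inPic⇔isCartier a

  isCartier-const⇔ι∣ : ∀ k → IsCartier v (λ _ → + k) ⇔ iotaFormula w μ η′ ℕ.∣ k
  isCartier-const⇔ι∣ k = begin
    IsCartier v (λ _ → + k)
      ∼⟨ isCartier⇔inSubgroupLM (λ _ → + k) ⟩
    InSubgroupLM w μ η′ (λ _ → + k)
      ∼⟨ inSubgroupLM⇔ (λ _ → + k) ⟩
    (+ LM w μ η′ ∣ degOf w (λ _ → + k) × (∀ j → + μ j ∣ torOf η′ (λ _ → + k) j))
      ∼⟨ +∣dot-const⇔ (λ l → w l) ×-⇔ Π-cong-⇔ (λ j → +∣dot-const⇔ (λ l → η′ l j)) ⟩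
    (LM w μ η′ ℕ.∣ k ℕ.* sumℕ w × (∀ j → μ j ℕ.∣ k ℕ.* sumℕ (λ l → η′ l j)))
      ∼⟨ ⇔-sym (ι∣⇔ k) ⟩
    iotaFormula w μ η′ ℕ.∣ k
      ∎
    where
    open EquationalReasoning
    +∣dot-const⇔ : ∀ {d} (c : Fin (suc n) → ℕ) →
                   + d ∣ dot (λ _ → + k) (λ l → + c l) ⇔ d ℕ.∣ k ℕ.* sumℕ c
    +∣dot-const⇔ {d} c
      rewrite dot-constˡ (+ k) (λ l → + c l) | sumℤ-pos c | sym (pos-* k (sumℕ c)) = mk⇔ ∣⇒∣ᵤ ∣ᵤ⇒∣

  isGorensteinIndex : IsGorensteinIndex v (iotaFormula w μ η′)
  isGorensteinIndex = ∣-characterises-least _ {{ι≢0}} isCartier-const⇔ι∣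

theorem3p3 : ∀ (n r : ℕ) (v : Fin (suc n) → Fin n → ℤ)
               (w : Fin (suc n) → ℕ) (μ : Fin r → ℕ)
               (η′ : Fin (suc n) → Fin r → ℕ) →
             IsFWPS n v →
             ClIdentification n r v w μ η′ →
             (∀ (a : Fin (suc n) → ℤ) → InPic v a ⇔ InSubgroupLM w μ η′ a)
             × IsGorensteinIndex v (iotaFormula w μ η′)
theorem3p3 n r v w μ η′ _ C = inPic⇔inSubgroupLM , isGorensteinIndex
  where open CartierDivisors C
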